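{- Let $f(x)=ax^2+bx+c$ be an irreducible quadratic polynomial in $\mathbb{Z}[x]$ with $a>0$ such that $f(x)$ is positive and increasing for real $x\ge 1$. For $n\ge 1$ and a prime $p$, let $\alpha_p(n)$ be the exponent of $p$ in $\prod_{i=1}^n f(i)$ and $\beta_p(n)$ the exponent of $p$ in $\operatorname{lcm}\{f(1),\dots,f(n)\}$. If $p\ge 2an+b$, then $\alpha_p(n)=\beta_p(n)$. -}

module Defs where

open import Data.Nat as ℕ using (ℕ; zero; suc; _^_)
open import Data.Nat.Divisibility using (_∣_)
open import Data.Nat.LCM using (lcm)
open import Data.Integer as ℤ using (ℤ; +_; -_; ∣_∣)
open import Data.Rational as ℚ using (ℚ)
open import Data.Product using (_×_; ∃-syntax)
open import Data.Sum using (_⊎_)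
open import Relation.Nullary using (¬_)
open import Relation.Binary.PropositionalEquality using (_≡_; _≢_)

evalℤ : ℤ → ℤ → ℤ → ℤ → ℤ
evalℤ a b c x = a ℤ.* x ℤ.* x ℤ.+ b ℤ.* x ℤ.+ c

evalℚ : ℤ → ℤ → ℤ → ℚ → ℚ
evalℚ a b c x = (a ℚ./ 1) ℚ.* x ℚ.* x ℚ.+ (b ℚ./ 1) ℚ.* x ℚ.+ (c ℚ./ 1)

-- Irreducibility of the degree-2 polynomial a x^2 + b x + c in ℤ[x]
-- (written out: it is nonzero of degree 2, and in any factorisation g*h one
-- factor is a unit ±1.  By degrees a factorisation is either
-- constant * quadratic, or linear * linear.)
IrreducibleQuadratic : ℤ → ℤ → ℤ → Set
IrreducibleQuadratic a b c =
  (a ≢ + 0)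
  × (∀ d a' b' c' → a ≡ d ℤ.* a' → b ≡ d ℤ.* b' → c ≡ d ℤ.* c' →
       (d ≡ + 1) ⊎ (d ≡ - (+ 1)))
  × (¬ (∃[ p ] ∃[ q ] ∃[ r ] ∃[ s ]
          (a ≡ p ℤ.* r) × (b ≡ p ℤ.* s ℤ.+ q ℤ.* r) × (c ≡ q ℤ.* s)))

prodF : ℤ → ℤ → ℤ → ℕ → ℤ
prodF a b c zero    = + 1
prodF a b c (suc n) = prodF a b c n ℤ.* evalℤ a b c (+ suc n)

lcmF : ℤ → ℤ → ℤ → ℕ → ℕ
lcmF a b c zero    = 1
lcmF a b c (suc n) = lcm (lcmF a b c n) ∣ evalℤ a b c (+ suc n) ∣

IsExponent : ℕ → ℕ → ℕ → Set
IsExponent p m k = (p ^ k ∣ m) × ¬ (p ^ suc k ∣ m)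

-- If p divided two of the values f(i), f(j) with 1 ≤ i < j ≤ n, it would divide
-- f(j) − f(i) = (j − i)(a(i + j) + b).  Since f(1) < f(2) forces 3a + b ≥ 1, both
-- factors lie in [1, p): indeed j − i ≤ a(i + j) + b < 2an + b ≤ p.  So p divides at
-- most one of f(1), …, f(n), and then every power of p divides the product exactly
-- when it divides the lcm, because a factor prime to p changes neither.
module Submission where

open import Defs
open import Data.Nat as ℕ using (ℕ; suc)
open import Data.Nat.Primality using (Prime)
open import Data.Integer as ℤ using (ℤ; +_; ∣_∣)
open import Data.Rational as ℚ using (ℚ)
open import Function.Bundles using (_⇔_)

open import Data.Nat using (zero; z≤n; s≤s; _+_; _*_; _^_; _≤_; _<_)
import Data.Nat.Properties as ℕP
open import Data.Nat.Divisibility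
  using (_∣_; _∣?_; divides; ∣-refl; ∣-trans; 1∣_; ∣1⇒≡1; >⇒∤; m∣m*n; n∣m*n; ∣m⇒∣m*n; ∣n⇒∣m*n;
         m*n∣⇒m∣; *-monoʳ-∣; *-cancelˡ-∣)
open import Data.Nat.LCM using (lcm; lcm-least; n∣lcm[m,n]; lcm-comm)
open import Data.Nat.Primality using (euclidsLemma; prime⇒nonZero; prime⇒nonTrivial)
import Data.Integer.Properties as ℤP
import Data.Integer.Divisibility.Signed as ℤ∣
open import Data.Integer.Tactic.RingSolver using (solve-∀)
open import Data.Rational.Unnormalised as ℚᵘ using (ℚᵘ; mkℚᵘ; *<*; *≡*)
import Data.Rational.Unnormalised.Properties as ℚᵘP
import Data.Rational.Properties as ℚP
open import Data.Product using (_,_)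
open import Data.Sum using (inj₁; inj₂; [_,_]′)
open import Function.Base using (_∘_)
open import Function.Bundles using (mk⇔; Equivalence)
import Function.Properties.Equivalence as ⇔
open import Relation.Binary.PropositionalEquality
open import Relation.Nullary using (¬_; yes; no; contradiction)

lcm∣* : ∀ m n → lcm m n ∣ m * n
lcm∣* m n = lcm-least {m} (m∣m*n n) (n∣m*n m)

module _ {p : ℕ} (isPrime : Prime p) where

  private instance
    p≢0 : ℕ.NonZero p
    p≢0 = prime⇒nonZero isPrime

  prime-pow-divisor : ∀ e {m n} → ¬ p ∣ m → p ^ e ∣ m * n → p ^ e ∣ n
  prime-pow-divisor zero    {n = n} _ _ = 1∣ n
  prime-pow-divisor (suc e) {m} p∤m pᵉ⁺¹∣mn
    with euclidsLemma m _ isPrime (m*n∣⇒m∣ p (p ^ e) pᵉ⁺¹∣mn)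
  ... | inj₁ p∣m = contradiction p∣m p∤m
  ... | inj₂ (divides q refl) =
    subst (p ^ suc e ∣_) (ℕP.*-comm p q) (*-monoʳ-∣ p (prime-pow-divisor e p∤m pᵉ∣mq))
    where
    m[qp]≡p[mq] : m * (q * p) ≡ p * (m * q)
    m[qp]≡p[mq] = trans (sym (ℕP.*-assoc m q p)) (ℕP.*-comm (m * q) p)

    pᵉ∣mq : p ^ e ∣ m * q
    pᵉ∣mq = *-cancelˡ-∣ p (subst (p ^ suc e ∣_) m[qp]≡p[mq] pᵉ⁺¹∣mn)

  pow∣*⇔pow∣ʳ : ∀ e {m n} → ¬ p ∣ m → (p ^ e ∣ m * n) ⇔ (p ^ e ∣ n)
  pow∣*⇔pow∣ʳ e {m} p∤m = mk⇔ (prime-pow-divisor e p∤m) (∣n⇒∣m*n m)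

  pow∣*⇔pow∣ˡ : ∀ e {m n} → ¬ p ∣ n → (p ^ e ∣ m * n) ⇔ (p ^ e ∣ m)
  pow∣*⇔pow∣ˡ e {m} {n} p∤n =
    subst (λ k → (p ^ e ∣ k) ⇔ (p ^ e ∣ m)) (ℕP.*-comm n m) (pow∣*⇔pow∣ʳ e p∤n)

  pow∣lcm⇔pow∣ʳ : ∀ e {m n} → ¬ p ∣ m → (p ^ e ∣ lcm m n) ⇔ (p ^ e ∣ n)
  pow∣lcm⇔pow∣ʳ e {m} {n} p∤m = mk⇔
    (λ pᵉ∣lcm → prime-pow-divisor e p∤m (∣-trans pᵉ∣lcm (lcm∣* m n)))
    (λ pᵉ∣n → ∣-trans pᵉ∣n (n∣lcm[m,n] m n))

  pow∣lcm⇔pow∣ˡ : ∀ e {m n} → ¬ p ∣ n → (p ^ e ∣ lcm m n) ⇔ (p ^ e ∣ m)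
  pow∣lcm⇔pow∣ˡ e {m} {n} p∤n =
    subst (λ k → (p ^ e ∣ k) ⇔ (p ^ e ∣ m)) (lcm-comm n m) (pow∣lcm⇔pow∣ʳ e p∤n)

productUpTo : (ℕ → ℕ) → ℕ → ℕ
productUpTo F zero    = 1
productUpTo F (suc m) = productUpTo F m * F (suc m)

lcmUpTo : (ℕ → ℕ) → ℕ → ℕ
lcmUpTo F zero    = 1
lcmUpTo F (suc m) = lcm (lcmUpTo F m) (F (suc m))

lcmUpTo∣productUpTo : ∀ F m → lcmUpTo F m ∣ productUpTo F m
lcmUpTo∣productUpTo F zero    = ∣-refl
lcmUpTo∣productUpTo F (suc m) =
  lcm-least (∣m⇒∣m*n (F (suc m)) (lcmUpTo∣productUpTo F m)) (n∣m*n (productUpTo F m))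

DividesAtMostOnce : ℕ → (ℕ → ℕ) → ℕ → Set
DividesAtMostOnce p F m = ∀ {i j} → 1 ≤ i → i < j → j ≤ m → p ∣ F i → ¬ p ∣ F j

module _ {p : ℕ} (isPrime : Prime p) {F : ℕ → ℕ} where

  prime∤productUpTo : ∀ m → (∀ {i} → 1 ≤ i → i ≤ m → ¬ p ∣ F i) → ¬ p ∣ productUpTo F m
  prime∤productUpTo zero    _   p∣1 = ℕ.nonTrivial⇒≢1 {{prime⇒nonTrivial isPrime}} (∣1⇒≡1 p∣1)
  prime∤productUpTo (suc m) p∤F p∣PF with euclidsLemma (productUpTo F m) (F (suc m)) isPrime p∣PF
  ... | inj₁ p∣P = prime∤productUpTo m (λ 1≤i i≤m → p∤F 1≤i (ℕP.m≤n⇒m≤1+n i≤m)) p∣P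
  ... | inj₂ p∣F = p∤F (s≤s z≤n) ℕP.≤-refl p∣F

  pow∣productUpTo⇔pow∣lcmUpTo : ∀ m → DividesAtMostOnce p F m →
    ∀ e → (p ^ e ∣ productUpTo F m) ⇔ (p ^ e ∣ lcmUpTo F m)
  pow∣productUpTo⇔pow∣lcmUpTo zero    _    e = ⇔.refl
  pow∣productUpTo⇔pow∣lcmUpTo (suc m) once e with p ∣? F (suc m)
  ... | no p∤F = ⇔.trans (pow∣*⇔pow∣ˡ isPrime e p∤F)
                 (⇔.trans (pow∣productUpTo⇔pow∣lcmUpTo m onceUpTo-m e)
                          (⇔.sym (pow∣lcm⇔pow∣ˡ isPrime e p∤F)))
    where
    onceUpTo-m : DividesAtMostOnce p F m
    onceUpTo-m 1≤i i<j j≤m = once 1≤i i<j (ℕP.m≤n⇒m≤1+n j≤m)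
  ... | yes p∣F = ⇔.trans (pow∣*⇔pow∣ʳ isPrime e p∤P) (⇔.sym (pow∣lcm⇔pow∣ʳ isPrime e p∤L))
    where
    p∤P : ¬ p ∣ productUpTo F m
    p∤P = prime∤productUpTo m (λ 1≤i i≤m p∣Fi → once 1≤i (s≤s i≤m) ℕP.≤-refl p∣Fi p∣F)

    p∤L : ¬ p ∣ lcmUpTo F m
    p∤L p∣L = p∤P (∣-trans p∣L (lcmUpTo∣productUpTo F m))

isExponent-cong : ∀ {p x y} → (∀ e → (p ^ e ∣ x) ⇔ (p ^ e ∣ y)) →
                  ∀ k → IsExponent p x k ⇔ IsExponent p y k
isExponent-cong {p} pow⇔ k = mk⇔ (transfer pow⇔) (transfer (⇔.sym ∘ pow⇔))
  where
  transfer : ∀ {x y} → (∀ e → (p ^ e ∣ x) ⇔ (p ^ e ∣ y)) → IsExponent p x k → IsExponent p y k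
  transfer pow⇔ (pᵏ∣x , pᵏ⁺¹∤x) =
    Equivalence.to (pow⇔ k) pᵏ∣x , pᵏ⁺¹∤x ∘ Equivalence.from (pow⇔ (suc k))

0<i<p⇒p∤∣i∣ : ∀ {p i} → + 1 ℤ.≤ i → i ℤ.< + p → ¬ p ∣ ∣ i ∣
0<i<p⇒p∤∣i∣ {i = + suc _} (ℤ.+≤+ _) (ℤ.+<+ i<p) = >⇒∤ i<p

module _ (a b c : ℤ) where

  -- ℚ arithmetic normalises, so it does not compute on variables; f(1) < f(2) is
  -- transported to ℤ through the unnormalised rationals, where ℤ embeds as mkℚᵘ z 0.
  evalℚᵘ : ℚᵘ → ℚᵘ
  evalℚᵘ x = mkℚᵘ a 0 ℚᵘ.* x ℚᵘ.* x ℚᵘ.+ mkℚᵘ b 0 ℚᵘ.* x ℚᵘ.+ mkℚᵘ c 0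

  toℚᵘ-evalℚ : ∀ x → ℚ.toℚᵘ (evalℚ a b c x) ℚᵘ.≃ evalℚᵘ (ℚ.toℚᵘ x)
  toℚᵘ-evalℚ x = begin
    ℚ.toℚᵘ (a ℚ./ 1 ℚ.* x ℚ.* x ℚ.+ b ℚ./ 1 ℚ.* x ℚ.+ c ℚ./ 1)
      ≈⟨ ℚP.toℚᵘ-homo-+ (a ℚ./ 1 ℚ.* x ℚ.* x ℚ.+ b ℚ./ 1 ℚ.* x) (c ℚ./ 1) ⟩
    ℚ.toℚᵘ (a ℚ./ 1 ℚ.* x ℚ.* x ℚ.+ b ℚ./ 1 ℚ.* x) ℚᵘ.+ ℚ.toℚᵘ (c ℚ./ 1)
      ≈⟨ ℚᵘP.+-cong (ℚP.toℚᵘ-homo-+ (a ℚ./ 1 ℚ.* x ℚ.* x) (b ℚ./ 1 ℚ.* x)) (toℚᵘ-/1 c) ⟩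
    ℚ.toℚᵘ (a ℚ./ 1 ℚ.* x ℚ.* x) ℚᵘ.+ ℚ.toℚᵘ (b ℚ./ 1 ℚ.* x) ℚᵘ.+ mkℚᵘ c 0
      ≈⟨ ℚᵘP.+-congˡ (mkℚᵘ c 0) (ℚᵘP.+-cong
           (ℚᵘP.≃-trans (ℚP.toℚᵘ-homo-* (a ℚ./ 1 ℚ.* x) x) (ℚᵘP.*-congʳ (toℚᵘ-scale a x)))
           (toℚᵘ-scale b x)) ⟩
    evalℚᵘ (ℚ.toℚᵘ x) ∎
    where
    open ℚᵘP.≃-Reasoning

    toℚᵘ-/1 : ∀ z → ℚ.toℚᵘ (z ℚ./ 1) ℚᵘ.≃ mkℚᵘ z 0
    toℚᵘ-/1 z = ℚP.toℚᵘ-fromℚᵘ (mkℚᵘ z 0)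

    toℚᵘ-scale : ∀ z y → ℚ.toℚᵘ (z ℚ./ 1 ℚ.* y) ℚᵘ.≃ mkℚᵘ z 0 ℚᵘ.* ℚ.toℚᵘ y
    toℚᵘ-scale z y = ℚᵘP.≃-trans (ℚP.toℚᵘ-homo-* (z ℚ./ 1) y) (ℚᵘP.*-congʳ (toℚᵘ-/1 z))

  evalℚᵘ-mkℚᵘ : ∀ x → evalℚᵘ (mkℚᵘ x 0) ℚᵘ.≃ mkℚᵘ (evalℤ a b c x) 0
  evalℚᵘ-mkℚᵘ x = *≡* (cong (ℤ._* + 1) numerator≡)
    where
    numerator≡ : ℚᵘ.↥ (evalℚᵘ (mkℚᵘ x 0)) ≡ evalℤ a b c x
    numerator≡ = cong₂ ℤ._+_
      (trans (ℤP.*-identityʳ (a ℤ.* x ℤ.* x ℤ.* + 1 ℤ.+ b ℤ.* x ℤ.* + 1))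
             (cong₂ ℤ._+_ (ℤP.*-identityʳ (a ℤ.* x ℤ.* x)) (ℤP.*-identityʳ (b ℤ.* x))))
      (ℤP.*-identityʳ c)

  evalℚᵘ-cong : ∀ {x y} → x ℚᵘ.≃ y → evalℚᵘ x ℚᵘ.≃ evalℚᵘ y
  evalℚᵘ-cong x≃y = ℚᵘP.+-congˡ (mkℚᵘ c 0) (ℚᵘP.+-cong
    (ℚᵘP.*-cong (ℚᵘP.*-congˡ {mkℚᵘ a 0} x≃y) x≃y) (ℚᵘP.*-congˡ {mkℚᵘ b 0} x≃y))

  toℚᵘ-evalℚ-/1 : ∀ z → ℚ.toℚᵘ (evalℚ a b c (z ℚ./ 1)) ℚᵘ.≃ mkℚᵘ (evalℤ a b c z) 0
  toℚᵘ-evalℚ-/1 z = ℚᵘP.≃-trans (toℚᵘ-evalℚ (z ℚ./ 1))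
    (ℚᵘP.≃-trans (evalℚᵘ-cong (ℚP.toℚᵘ-fromℚᵘ (mkℚᵘ z 0))) (evalℚᵘ-mkℚᵘ z))

  evalℤ-1<evalℤ-2 : (∀ (x y : ℚ) → ℚ.1ℚ ℚ.≤ x → x ℚ.< y → evalℚ a b c x ℚ.< evalℚ a b c y) →
                    evalℤ a b c (+ 1) ℤ.< evalℤ a b c (+ 2)
  evalℤ-1<evalℤ-2 increasing = mkℚᵘ-cancel-<
    (ℚᵘP.<-respˡ-≃ (toℚᵘ-evalℚ-/1 (+ 1)) (ℚᵘP.<-respʳ-≃ (toℚᵘ-evalℚ-/1 (+ 2))
      (ℚP.toℚᵘ-mono-< (increasing ℚ.1ℚ (+ 2 ℚ./ 1) ℚP.≤-refl (ℚ.*<* (ℤ.+<+ (s≤s (s≤s z≤n))))))))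
    where
    mkℚᵘ-cancel-< : ∀ {x y} → mkℚᵘ x 0 ℚᵘ.< mkℚᵘ y 0 → x ℤ.< y
    mkℚᵘ-cancel-< (*<* x*1<y*1) = subst₂ ℤ._<_ (ℤP.*-identityʳ _) (ℤP.*-identityʳ _) x*1<y*1

  -- For i = 1 + u < j = 2 + u + v, so that j − i = 1 + v, this is a(i + j) + b.
  cofactor : ℕ → ℕ → ℤ
  cofactor u v = + 3 ℤ.* a ℤ.+ b ℤ.+ a ℤ.* + (u + u + v)

  evalℤ-gap : ∀ u v →
    evalℤ a b c (+ (2 + u + v)) ℤ.- evalℤ a b c (+ suc u) ≡ + suc v ℤ.* cofactor u v
  evalℤ-gap u v = gap-identity a b c (+ u) (+ v)
    where
    gap-identity : ∀ a b c u v →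
      (a ℤ.* (+ 2 ℤ.+ u ℤ.+ v) ℤ.* (+ 2 ℤ.+ u ℤ.+ v) ℤ.+ b ℤ.* (+ 2 ℤ.+ u ℤ.+ v) ℤ.+ c)
        ℤ.- (a ℤ.* (+ 1 ℤ.+ u) ℤ.* (+ 1 ℤ.+ u) ℤ.+ b ℤ.* (+ 1 ℤ.+ u) ℤ.+ c)
      ≡ (+ 1 ℤ.+ v) ℤ.* (+ 3 ℤ.* a ℤ.+ b ℤ.+ a ℤ.* (u ℤ.+ u ℤ.+ v))
    gap-identity = solve-∀

  ∣evalℤ⇒∣gap*cofactor : ∀ {d} u v →
    d ∣ ∣ evalℤ a b c (+ suc u) ∣ → d ∣ ∣ evalℤ a b c (+ (2 + u + v)) ∣ →
    d ∣ suc v * ∣ cofactor u v ∣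
  ∣evalℤ⇒∣gap*cofactor {d} u v d∣fᵢ d∣fⱼ =
    subst (d ∣_) (ℤP.abs-* (+ suc v) (cofactor u v))
          (ℤ∣.∣⇒∣ᵤ (subst (+ d ℤ∣.∣_) (evalℤ-gap u v) d∣fⱼ-fᵢ))
    where
    fᵢ fⱼ : ℤ
    fᵢ = evalℤ a b c (+ suc u)
    fⱼ = evalℤ a b c (+ (2 + u + v))

    d∣fⱼ-fᵢ : + d ℤ∣.∣ (fⱼ ℤ.- fᵢ)
    d∣fⱼ-fᵢ = ℤ∣.∣m∣n⇒∣m-n (ℤ∣.∣ᵤ⇒∣ {i = fⱼ} d∣fⱼ) (ℤ∣.∣ᵤ⇒∣ {i = fᵢ} d∣fᵢ)

  f₁<f₂⇒1≤3a+b : evalℤ a b c (+ 1) ℤ.< evalℤ a b c (+ 2) → + 1 ℤ.≤ + 3 ℤ.* a ℤ.+ b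
  f₁<f₂⇒1≤3a+b f₁<f₂ = ℤP.0≤i-j⇒j≤i
    (subst (+ 0 ℤ.≤_) (f₂-[1+f₁] a b c) (ℤP.i≤j⇒0≤j-i (ℤP.i<j⇒suc[i]≤j f₁<f₂)))
    where
    f₂-[1+f₁] : ∀ a b c →
      (a ℤ.* + 2 ℤ.* + 2 ℤ.+ b ℤ.* + 2 ℤ.+ c) ℤ.- (+ 1 ℤ.+ (a ℤ.* + 1 ℤ.* + 1 ℤ.+ b ℤ.* + 1 ℤ.+ c))
      ≡ (+ 3 ℤ.* a ℤ.+ b) ℤ.- + 1
    f₂-[1+f₁] = solve-∀

  module _ (0<a : + 0 ℤ.< a) (1≤3a+b : + 1 ℤ.≤ + 3 ℤ.* a ℤ.+ b) where

    private instance
      a>0 : ℤ.Positive a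
      a>0 = ℤ.positive 0<a

    1+v≤cofactor : ∀ u v → + suc v ℤ.≤ cofactor u v
    1+v≤cofactor u v =
      ℤP.+-mono-≤ 1≤3a+b (ℤP.≤-trans (ℤ.+≤+ (ℕP.m≤n+m v (u + u))) (w≤a*w (u + u + v)))
      where
      w≤a*w : ∀ w → + w ℤ.≤ a ℤ.* + w
      w≤a*w w = subst (ℤ._≤ a ℤ.* + w) (ℤP.*-identityˡ (+ w))
                      (ℤP.*-monoʳ-≤-nonNeg (+ w) (ℤP.i<j⇒suc[i]≤j 0<a))

    cofactor<2an+b : ∀ {u v n} → 2 + u + v ≤ n → cofactor u v ℤ.< + 2 ℤ.* a ℤ.* + n ℤ.+ b
    cofactor<2an+b {u} {v} {n} j≤n = begin-strict
      cofactor u v                            ≡⟨ regroup a b (+ u) (+ v) ⟩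
      a ℤ.* (+ suc u ℤ.+ + (2 + u + v)) ℤ.+ b  <⟨ ℤP.+-monoˡ-< b (ℤP.*-monoˡ-<-pos a i+j<n+n) ⟩
      a ℤ.* (+ n ℤ.+ + n) ℤ.+ b                ≡⟨ cong (ℤ._+ b) (double a (+ n)) ⟩
      + 2 ℤ.* a ℤ.* + n ℤ.+ b                  ∎
      where
      open ℤP.≤-Reasoning

      i+j<n+n : + suc u ℤ.+ + (2 + u + v) ℤ.< + n ℤ.+ + n
      i+j<n+n = ℤP.+-mono-<-≤ (ℤ.+<+ (ℕP.<-≤-trans (s≤s (s≤s (ℕP.m≤m+n u v))) j≤n)) (ℤ.+≤+ j≤n)

      regroup : ∀ a b u v →
        + 3 ℤ.* a ℤ.+ b ℤ.+ a ℤ.* (u ℤ.+ u ℤ.+ v) ≡ a ℤ.* ((+ 1 ℤ.+ u) ℤ.+ (+ 2 ℤ.+ u ℤ.+ v)) ℤ.+ b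
      regroup = solve-∀

      double : ∀ a n → a ℤ.* (n ℤ.+ n) ≡ + 2 ℤ.* a ℤ.* n
      double = solve-∀

    evalℤ-dividesAtMostOnce : ∀ {p n} → Prime p → + 2 ℤ.* a ℤ.* + n ℤ.+ b ℤ.≤ + p →
                              DividesAtMostOnce p (λ i → ∣ evalℤ a b c (+ i) ∣) n
    evalℤ-dividesAtMostOnce {p} isPrime 2an+b≤p {suc u} (s≤s z≤n) i<j j≤n p∣fᵢ p∣fⱼ
      with ℕP.m≤n⇒∃[o]m+o≡n i<j
    ... | v , refl =
      [ 0<i<p⇒p∤∣i∣ (ℤ.+≤+ (s≤s z≤n)) (ℤP.≤-<-trans gap≤cofactor cofactor<p)
      , 0<i<p⇒p∤∣i∣ {i = cofactor u v} (ℤP.≤-trans (ℤ.+≤+ (s≤s z≤n)) gap≤cofactor) cofactor<p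
      ]′ (euclidsLemma (suc v) ∣ cofactor u v ∣ isPrime (∣evalℤ⇒∣gap*cofactor u v p∣fᵢ p∣fⱼ))
      where
      gap≤cofactor : + suc v ℤ.≤ cofactor u v
      gap≤cofactor = 1+v≤cofactor u v

      cofactor<p : cofactor u v ℤ.< + p
      cofactor<p = ℤP.<-≤-trans (cofactor<2an+b {u} {v} j≤n) 2an+b≤p

  ∣prodF∣≡productUpTo : ∀ m → ∣ prodF a b c m ∣ ≡ productUpTo (λ i → ∣ evalℤ a b c (+ i) ∣) m
  ∣prodF∣≡productUpTo zero    = refl
  ∣prodF∣≡productUpTo (suc m) = trans (ℤP.abs-* (prodF a b c m) (evalℤ a b c (+ suc m)))
                                      (cong (_* ∣ evalℤ a b c (+ suc m) ∣) (∣prodF∣≡productUpTo m))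

  lcmF≡lcmUpTo : ∀ m → lcmF a b c m ≡ lcmUpTo (λ i → ∣ evalℤ a b c (+ i) ∣) m
  lcmF≡lcmUpTo zero    = refl
  lcmF≡lcmUpTo (suc m) = cong (λ l → lcm l ∣ evalℤ a b c (+ suc m) ∣) (lcmF≡lcmUpTo m)

mainTheorem5 : (a b c : ℤ) → IrreducibleQuadratic a b c → + 0 ℤ.< a
    → (∀ (x : ℚ) → ℚ.1ℚ ℚ.≤ x → ℚ.0ℚ ℚ.< evalℚ a b c x)
    → (∀ (x y : ℚ) → ℚ.1ℚ ℚ.≤ x → x ℚ.< y → evalℚ a b c x ℚ.< evalℚ a b c y)
    → (n p : ℕ) → 1 ℕ.≤ n → Prime p
    → (+ 2) ℤ.* a ℤ.* (+ n) ℤ.+ b ℤ.≤ + p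
    → (k : ℕ) → IsExponent p ∣ prodF a b c n ∣ k ⇔ IsExponent p (lcmF a b c n) k
mainTheorem5 a b c _ 0<a _ increasing n p _ isPrime 2an+b≤p k =
  subst₂ (λ P L → IsExponent p P k ⇔ IsExponent p L k)
    (sym (∣prodF∣≡productUpTo a b c n)) (sym (lcmF≡lcmUpTo a b c n))
    (isExponent-cong (pow∣productUpTo⇔pow∣lcmUpTo isPrime n atMostOnce) k)
  where
  atMostOnce : DividesAtMostOnce p (λ i → ∣ evalℤ a b c (+ i) ∣) n
  atMostOnce = evalℤ-dividesAtMostOnce a b c 0<a 1≤3a+b isPrime 2an+b≤p
    where
    1≤3a+b : + 1 ℤ.≤ + 3 ℤ.* a ℤ.+ b
    1≤3a+b = f₁<f₂⇒1≤3a+b a b c (evalℤ-1<evalℤ-2 a b c increasing)
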